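{- Let $n>3$ and consider the $n$-vertex Fibonacci graph $FG$ (vertices $1,\dots,n$; edges $(v,v+1)$ labelled $a_v$ for $1\le v\le n-1$ and $(v,v+2)$ labelled $b_v$ for $1\le v\le n-2$). The expression of $FG$ produced by a reduction process does not depend on the order in which the fork steps and joint steps are executed, but only on the number of fork steps (equivalently, the number of joint steps).
   Context: Reduction processes. Edges carry labels (algebraic expressions); initially edge $(v,v+1)$ has label $a_v$ and $(v,v+2)$ has label $b_v$. At every stage the current labelled graph has vertices $u_1<u_2<\dots<u_k$ (with $u_1=1$, $u_k=n$) and edges $(u_r,u_{r+1})$ and $(u_r,u_{r+2})$. While $k>3$, one step of one of two kinds is performed: (Fork step) Let $A,B,C,D$ be the labels of $(u_1,u_2),(u_2,u_3),(u_2,u_4),(u_1,u_3)$. Delete $u_2$ and its three incident edges, add an edge $(u_1,u_4)$ labelled $AC$, and replace the edge $(u_1,u_3)$ by one labelled $D+AB$. (Joint step) Let $A,B,C,D$ be the labels of $(u_{k-1},u_k),(u_{k-2},u_{k-1}),(u_{k-3},u_{k-1}),(u_{k-2},u_k)$. Delete $u_{k-1}$ and its three incident edges, add an edge $(u_{k-3},u_k)$ labelled $CA$, and replace the edge $(u_{k-2},u_k)$ by one labelled $D+BA$. Each step decreases $k$ by one, so exactly $n-3$ steps are performed; a reduction process is a choice of fork/joint for each step. When $k=3$, with labels $A,B,D$ on $(u_1,u_2),(u_2,u_3),(u_1,u_3)$, a series and a parallel reduction yield a single edge labelled $D+AB$; this label is the expression of $FG$ produced by the process. -}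

module Defs where

open import Data.Nat using (ℕ; zero; suc; _+_; _∸_)
open import Data.Bool using (Bool; true; false)
open import Data.Fin using (Fin; toℕ)
open import Data.Vec using (Vec; []; _∷_; reverse; tabulate)

infixl 6 _⊕_
infixl 7 _⊗_
data Expr : Set where
  a   : ℕ → Expr
  b   : ℕ → Expr
  _⊕_ : Expr → Expr → Expr
  _⊗_ : Expr → Expr → Expr

-- Equality of expressions: products are written by juxtaposition (AC, AB, CA, BA)
-- without parentheses, i.e. expressions are identified up to associativity of
-- the product.  _≈_ is the congruence generated by associativity of _⊗_.
infix 4 _≈_
data _≈_ : Expr → Expr → Set where
  ≈-refl  : ∀ {x} → x ≈ x
  ≈-sym   : ∀ {x y} → x ≈ y → y ≈ x
  ≈-trans : ∀ {x y z} → x ≈ y → y ≈ z → x ≈ z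
  ⊕-cong  : ∀ {x x′ y y′} → x ≈ x′ → y ≈ y′ → x ⊕ y ≈ x′ ⊕ y′
  ⊗-cong  : ∀ {x x′ y y′} → x ≈ x′ → y ≈ y′ → x ⊗ y ≈ x′ ⊗ y′
  ⊗-assoc : ∀ x y z → (x ⊗ y) ⊗ z ≈ x ⊗ (y ⊗ z)

-- A labelled graph at a stage with k = j + 3 vertices u_1 < ... < u_k is given by
-- the labels of the edges (u_r , u_{r+1})  (vector of length k-1 = j+2) and
-- the labels of the edges (u_r , u_{r+2})  (vector of length k-2 = j+1).
record Stage (j : ℕ) : Set where
  constructor stage
  field
    short : Vec Expr (suc (suc j))
    long  : Vec Expr (suc j)

-- Fork step: A,B,C,D = labels of (u1,u2),(u2,u3),(u2,u4),(u1,u3).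
-- New (u1,u3) label D + AB, new (u1,u4) label AC.
fork : ∀ {j} → Stage (suc j) → Stage j
fork (stage (A ∷ B ∷ as) (D ∷ C ∷ bs)) = stage ((D ⊕ A ⊗ B) ∷ as) ((A ⊗ C) ∷ bs)

-- Joint step, on the reversed label vectors:
-- A,B,C,D = labels of (u_{k-1},u_k),(u_{k-2},u_{k-1}),(u_{k-3},u_{k-1}),(u_{k-2},u_k).
-- New (u_{k-2},u_k) label D + BA, new (u_{k-3},u_k) label CA.
jointRev : ∀ {j} → Vec Expr (suc (suc (suc j))) → Vec Expr (suc (suc j)) → Stage j
jointRev (A ∷ B ∷ ras) (D ∷ C ∷ rbs) =
  stage (reverse ((D ⊕ B ⊗ A) ∷ ras)) (reverse ((C ⊗ A) ∷ rbs))

joint : ∀ {j} → Stage (suc j) → Stage j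
joint (stage as bs) = jointRev (reverse as) (reverse bs)

run : ∀ {j} → Vec Bool j → Stage j → Stage 0
run []            s = s
run (true  ∷ p) s = run p (fork s)
run (false ∷ p) s = run p (joint s)

final : Stage 0 → Expr
final (stage (A ∷ B ∷ []) (D ∷ [])) = D ⊕ A ⊗ B

FG : (j : ℕ) → Stage j
FG j = stage (tabulate (λ i → a (suc (toℕ i)))) (tabulate (λ i → b (suc (toℕ i))))

expression : (n : ℕ) → Vec Bool (n ∸ 3) → Expr
expression n p = final (run p (FG (n ∸ 3)))

forks : ∀ {j} → Vec Bool j → ℕ
forks []          = 0
forks (true ∷ p)  = suc (forks p)
forks (false ∷ p) = forks p

-- A fork step only touches the edges at the front of the vertex sequence and a
-- joint step only those at the back.  Once at least five vertices remain these
-- edge sets are disjoint, so the two steps commute on the nose.  With four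
-- vertices both steps rewrite the edge (u₁,u₄), and the two orders produce the
-- labels A(CA′) and (AC)A′, which agree up to associativity.  Hence swapping an
-- adjacent fork and joint never changes the final expression, and bubble-sorting
-- moves every process to the one performing all of its forks first.
module Submission where

open import Defs
open import Data.Nat using (ℕ; zero; suc; _<_; _≤_; _∸_; z≤n; s≤s)
open import Data.Nat.Properties using (m≤n⇒m≤1+n)
open import Data.Bool using (Bool; true; false)
open import Data.Product using (_,_)
open import Data.Vec using (Vec; []; _∷_; _∷ʳ_; reverse; initLast)
open import Data.Vec.Properties using (reverse-∷; reverse-involutive; reverse-reverse)
open import Relation.Binary.PropositionalEquality
  using (_≡_; refl; trans; cong; cong₂; module ≡-Reasoning)

reverse-∷-reverse : ∀ {A : Set} {n} (xs : Vec A n) x → reverse (x ∷ reverse xs) ≡ xs ∷ʳ x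
reverse-∷-reverse xs x = trans (reverse-∷ x (reverse xs)) (cong (_∷ʳ x) (reverse-involutive xs))

reverse-∷ʳ : ∀ {A : Set} {n} (xs : Vec A n) x → reverse (xs ∷ʳ x) ≡ x ∷ reverse xs
reverse-∷ʳ xs x = reverse-reverse (reverse-∷-reverse xs x)

joint-∷ʳ : ∀ {j} (ss : Vec Expr (suc j)) B A (ls : Vec Expr j) C D →
  joint (stage (ss ∷ʳ B ∷ʳ A) (ls ∷ʳ C ∷ʳ D)) ≡ stage (ss ∷ʳ (D ⊕ B ⊗ A)) (ls ∷ʳ (C ⊗ A))
joint-∷ʳ ss B A ls C D
  rewrite reverse-∷ʳ (ss ∷ʳ B) A | reverse-∷ʳ ss B | reverse-∷ʳ (ls ∷ʳ C) D | reverse-∷ʳ ls C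
  = cong₂ stage (reverse-∷-reverse ss (D ⊕ B ⊗ A)) (reverse-∷-reverse ls (C ⊗ A))

fork∘joint≡joint∘fork : ∀ {j} (s : Stage (suc (suc (suc j)))) → fork (joint s) ≡ joint (fork s)
fork∘joint≡joint∘fork (stage (x₀ ∷ x₁ ∷ xs) (y₀ ∷ y₁ ∷ ys))
  with initLast xs | initLast ys
... | xs′ , A , refl | ys′ , D , refl with initLast xs′ | initLast ys′
... | mid , B , refl | ymid , C , refl = begin
  fork (joint (stage (x₀ ∷ x₁ ∷ (mid ∷ʳ B ∷ʳ A)) (y₀ ∷ y₁ ∷ (ymid ∷ʳ C ∷ʳ D))))
    ≡⟨ cong fork (joint-∷ʳ (x₀ ∷ x₁ ∷ mid) B A (y₀ ∷ y₁ ∷ ymid) C D) ⟩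
  stage ((y₀ ⊕ x₀ ⊗ x₁) ∷ (mid ∷ʳ (D ⊕ B ⊗ A))) ((x₀ ⊗ y₁) ∷ (ymid ∷ʳ (C ⊗ A)))
    ≡⟨ joint-∷ʳ ((y₀ ⊕ x₀ ⊗ x₁) ∷ mid) B A ((x₀ ⊗ y₁) ∷ ymid) C D ⟨
  joint (fork (stage (x₀ ∷ x₁ ∷ (mid ∷ʳ B ∷ʳ A)) (y₀ ∷ y₁ ∷ (ymid ∷ʳ C ∷ʳ D)))) ∎
  where open ≡-Reasoning

final-fork∘joint≈final-joint∘fork : (s : Stage 2) → final (fork (joint s)) ≈ final (joint (fork s))
final-fork∘joint≈final-joint∘fork (stage (x₀ ∷ _ ∷ _ ∷ x₃ ∷ []) (_ ∷ y₁ ∷ _ ∷ [])) =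
  ⊕-cong (≈-sym (⊗-assoc x₀ y₁ x₃)) ≈-refl

final-run-fork-joint-swap : ∀ {j} (r : Vec Bool j) (s : Stage (suc (suc j))) →
  final (run (false ∷ true ∷ r) s) ≈ final (run (true ∷ false ∷ r) s)
final-run-fork-joint-swap []      s = final-fork∘joint≈final-joint∘fork s
final-run-fork-joint-swap (_ ∷ _) s rewrite fork∘joint≡joint∘fork s = ≈-refl

forksFirst : (j m : ℕ) → Vec Bool j
forksFirst zero    _       = []
forksFirst (suc j) zero    = false ∷ forksFirst j zero
forksFirst (suc j) (suc m) = true ∷ forksFirst j m

forks≤length : ∀ {j} (p : Vec Bool j) → forks p ≤ j
forks≤length []          = z≤n
forks≤length (true ∷ p)  = s≤s (forks≤length p)
forks≤length (false ∷ p) = m≤n⇒m≤1+n (forks≤length p)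

final-run-joint∷forksFirst : ∀ {j} m → m ≤ j → (s : Stage (suc j)) →
  final (run (false ∷ forksFirst j m) s) ≈ final (run (forksFirst (suc j) m) s)
final-run-joint∷forksFirst zero    _         s = ≈-refl
final-run-joint∷forksFirst (suc m) (s≤s m≤j) s =
  ≈-trans (final-run-fork-joint-swap (forksFirst _ m) s)
          (final-run-joint∷forksFirst m m≤j (fork s))

final-run≈forksFirst : ∀ {j} (p : Vec Bool j) (s : Stage j) →
  final (run p s) ≈ final (run (forksFirst j (forks p)) s)
final-run≈forksFirst []          s = ≈-refl
final-run≈forksFirst (true ∷ p)  s = final-run≈forksFirst p (fork s)
final-run≈forksFirst (false ∷ p) s =
  ≈-trans (final-run≈forksFirst p (joint s))
          (final-run-joint∷forksFirst (forks p) (forks≤length p) s)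

final-run-determined-by-forks : ∀ {j} (p q : Vec Bool j) (s : Stage j) →
  forks p ≡ forks q → final (run p s) ≈ final (run q s)
final-run-determined-by-forks {j} p q s forks-p≡forks-q =
  ≈-trans (final-run≈forksFirst p s) (≈-sym q≈forksFirst)
  where
  q≈forksFirst : final (run q s) ≈ final (run (forksFirst j (forks p)) s)
  q≈forksFirst rewrite forks-p≡forks-q = final-run≈forksFirst q s

proposition1 : (n : ℕ) → 3 < n → (p q : Vec Bool (n ∸ 3)) →
    forks p ≡ forks q → expression n p ≈ expression n q
proposition1 n _ p q = final-run-determined-by-forks p q (FG (n ∸ 3))
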